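{- Let $p$ be a prime and $t\in\mathbb{Z}_p$. Then the function $f_t\colon\mathbb{Z}\to\mathbb{N}\cup\{\infty\}$, $f_t(k)=v_p(k-t)$, is almost periodic.
   Context: $\mathbb{Z}_p$ denotes the $p$-adic integers and $v_p\colon\mathbb{Z}_p\to\mathbb{N}\cup\{\infty\}$ the $p$-adic valuation ($v_p(0)=\infty$). A function $f\colon\mathbb{Z}\to\mathbb{N}\cup\{\infty\}$ is almost periodic if it is not periodic but for every $n\in\mathbb{N}$ the function $\min(n,f)$ is periodic. -}

module Defs where

open import Data.Nat as ℕ using (ℕ; zero; suc; _^_; _<_; _≥_)
open import Data.Integer as ℤ using (ℤ; +_; _+_; _-_)
open import Data.Integer.Divisibility.Signed using (_∣_; _∣?_; ∣-trans; ∣m⇒∣m*n; ∣m∣n⇒∣m+n; ∣-refl; divides)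
open import Data.Bool using (Bool; true; false; T; if_then_else_)
open import Data.Product using (Σ; _×_; _,_)
open import Data.Empty using (⊥)
open import Relation.Nullary using (¬_; does)
open import Relation.Nullary.Decidable using (toWitness; fromWitness; ⌊_⌋)
open import Relation.Binary.PropositionalEquality using (_≡_; refl; sym; subst)
open import Data.Integer.Solver using (module +-*-Solver)
open +-*-Solver

-- p-adic integers ℤ_p as the inverse limit of ℤ/pⁿℤ: a coherent system
-- of residues res n ∈ {0,…,pⁿ-1} with res (n+1) ≡ res n (mod pⁿ).

record ℤ[_] (p : ℕ) : Set where
  field
    res  : ℕ → ℕ
    res< : ∀ n → res n < p ^ n
    coh  : ∀ n → (+ (p ^ n)) ∣ (+ res (suc n) - + res n)
open ℤ[_] public

-- ℕ ∪ {∞} (constructive "conatural numbers"): a value x is encoded by the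
-- decreasing Boolean sequence  gt n = (x > n).  ∞ is the constant true
-- sequence; the natural number m has gt n = true exactly for n < m.

record ℕ∞ : Set where
  field
    gt   : ℕ → Bool
    mono : ∀ n → T (gt (suc n)) → T (gt n)
open ℕ∞ public

_≈∞_ : ℕ∞ → ℕ∞ → Set
x ≈∞ y = ∀ n → gt x n ≡ gt y n

minℕ∞ : ℕ → (ℕ → Bool) → ℕ
minℕ∞ zero    α = 0
minℕ∞ (suc n) α = if α 0 then suc (minℕ∞ n (λ i → α (suc i))) else 0

min∞ : ℕ → ℕ∞ → ℕ
min∞ n x = minℕ∞ n (gt x)

-- p-adic valuation v_p(k - t) for k ∈ ℤ ⊂ ℤ_p and t ∈ ℤ_p:
-- v_p(k - t) ≥ m  iff  pᵐ ∣ k - t  iff  k ≡ res t m (mod pᵐ).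

vp≥ : (p : ℕ) → ℤ → ℤ[ p ] → ℕ → Set
vp≥ p k t m = (+ (p ^ m)) ∣ (k - + res t m)

private
  split : ∀ k a b → k - b ≡ (k - a) + (a - b)
  split = solve 3 (λ k a b → k :- b := (k :- a) :+ (a :- b)) refl

  pm∣pm+1 : ∀ p m → (+ (p ^ m)) ∣ (+ (p ^ suc m))
  pm∣pm+1 p m = divides (+ p) (Data.Integer.Properties.pos-* p (p ^ m))
    where import Data.Nat.Properties as ℕ
          import Data.Integer.Properties

  vp≥-mono : ∀ p k t m → vp≥ p k t (suc m) → vp≥ p k t m
  vp≥-mono p k t m h =
    subst ((+ (p ^ m)) ∣_) (sym (split k (+ res t (suc m)) (+ res t m)))
      (∣m∣n⇒∣m+n (∣-trans (pm∣pm+1 p m) h) (coh t m))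

vp-diff : (p : ℕ) → ℤ[ p ] → ℤ → ℕ∞
gt   (vp-diff p t k) n = ⌊ (+ (p ^ suc n)) ∣? (k - + res t (suc n)) ⌋
mono (vp-diff p t k) n h =
  fromWitness {a? = (+ (p ^ suc n)) ∣? (k - + res t (suc n))}
    (vp≥-mono p k t (suc n) (toWitness {a? = (+ (p ^ suc (suc n))) ∣? (k - + res t (suc (suc n)))} h))

Periodic : {A : Set} → (A → A → Set) → (ℤ → A) → Set
Periodic _≈_ f = Σ ℕ λ P → P ≥ 1 × (∀ k → f (k + + P) ≈ f k)

PeriodicNat : (ℤ → ℕ) → Set
PeriodicNat = Periodic _≡_

AlmostPeriodic : (ℤ → ℕ∞) → Set
AlmostPeriodic f = ¬ Periodic _≈∞_ f × (∀ n → PeriodicNat (λ k → min∞ n (f k)))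

{-# OPTIONS --safe #-}
module Submission where

-- Whether v_p(k − t) ≥ m depends only on k mod pᵐ, so min(n, f_t) has period pⁿ.
-- A period P of f_t itself would give v_p(r + P − t) = v_p(r − t) ≥ P for r ≡ t (mod pᴾ),
-- hence pᴾ ∣ P, impossible since P < pᴾ.

open import Defs
open import Data.Nat using (ℕ)
open import Data.Nat.Primality using (Prime)

open import Data.Bool using (Bool; T; if_then_else_)
open import Data.Integer using (+_; _+_; _-_)
open import Data.Integer.Divisibility.Signed
  using (_∣_; _∣?_; ∣ᵤ⇒∣; ∣⇒∣ᵤ; ∣m∣n⇒∣m+n; ∣m+n∣n⇒∣m)
open import Data.Integer.Properties using (+-inverseʳ)
open import Data.Integer.Solver using (module +-*-Solver)
open import Data.Nat.Base
  using (suc; zero; _^_; _≤_; _<_; z≤n; s≤s; z<s; NonZero; >-nonZero; nonTrivial⇒n>1)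
import Data.Nat.Divisibility as ℕ
open import Data.Nat.Properties using (≤-<-trans; <-trans; n<1+n; ^-monoʳ-<; m^n>0)
open import Data.Product using (_,_)
open import Function.Base using (_∘_)
open import Function.Bundles using (_⇔_; mk⇔)
open import Relation.Nullary using (¬_; Dec)
open import Relation.Nullary.Decidable
  using (⌊_⌋; toWitness; fromWitness; isYes≗does; does-⇔)
open import Relation.Binary.PropositionalEquality using (_≡_; refl; sym; trans; subst; cong)

open +-*-Solver

n<m^n : ∀ m → 1 < m → ∀ n → n < m ^ n
n<m^n m 1<m zero    = z<s
n<m^n m 1<m (suc n) = ≤-<-trans (n<m^n m 1<m n) (^-monoʳ-< m 1<m (n<1+n n))

m≤n⇒k^m∣k^n : ∀ k {m n} → m ≤ n → k ^ m ℕ.∣ k ^ n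
m≤n⇒k^m∣k^n k z≤n       = ℕ.1∣ _
m≤n⇒k^m∣k^n k (s≤s m≤n) = ℕ.*-monoʳ-∣ k (m≤n⇒k^m∣k^n k m≤n)

⌊⌋-⇔ : ∀ {A B : Set} → A ⇔ B → (a? : Dec A) (b? : Dec B) → ⌊ a? ⌋ ≡ ⌊ b? ⌋
⌊⌋-⇔ A⇔B a? b? = trans (isYes≗does a?) (trans (does-⇔ A⇔B a? b?) (sym (isYes≗does b?)))

minℕ∞-cong : ∀ n {α β : ℕ → Bool} → (∀ {i} → i < n → α i ≡ β i) → minℕ∞ n α ≡ minℕ∞ n β
minℕ∞-cong zero    α≡β = refl
minℕ∞-cong (suc n) {α} {β} α≡β rewrite α≡β z<s =
  cong (λ m → if β 0 then suc m else 0) (minℕ∞-cong n (λ i<n → α≡β (s≤s i<n)))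

module _ (p : ℕ) (t : ℤ[ p ]) where

  gt-vp-diff-cong : ∀ k l n → (vp≥ p k t (suc n) ⇔ vp≥ p l t (suc n)) →
                    gt (vp-diff p t k) n ≡ gt (vp-diff p t l) n
  gt-vp-diff-cong k l n k⇔l = ⌊⌋-⇔ k⇔l (_ ∣? _) (_ ∣? _)

  vp≥-res : ∀ m → vp≥ p (+ res t m) t m
  vp≥-res m = subst (+ (p ^ m) ∣_) (sym (+-inverseʳ (+ res t m))) (∣ᵤ⇒∣ (ℕ._∣0 _))

  vp≥-+-period : ∀ k {P} m → + (p ^ m) ∣ + P → vp≥ p (k + + P) t m ⇔ vp≥ p k t m
  vp≥-+-period k {P} m pᵐ∣P = mk⇔
    (λ h → ∣m+n∣n⇒∣m (subst (+ (p ^ m) ∣_) shift h) pᵐ∣P)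
    (λ h → subst (+ (p ^ m) ∣_) (sym shift) (∣m∣n⇒∣m+n h pᵐ∣P))
    where
      shift : (k + + P) - + res t m ≡ (k - + res t m) + + P
      shift = solve 3 (λ k P r → (k :+ P) :- r := (k :- r) :+ P) refl k (+ P) (+ res t m)

  min∞-vp-diff-periodic : .{{NonZero p}} → ∀ n → PeriodicNat (λ k → min∞ n (vp-diff p t k))
  min∞-vp-diff-periodic n = p ^ n , m^n>0 p n , λ k → minℕ∞-cong n λ {i} i<n →
    gt-vp-diff-cong (k + + (p ^ n)) k i (vp≥-+-period k (suc i) (∣ᵤ⇒∣ (m≤n⇒k^m∣k^n p i<n)))

  ≈∞⇒vp≥ : ∀ k l n → vp-diff p t k ≈∞ vp-diff p t l → vp≥ p l t (suc n) → vp≥ p k t (suc n)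
  ≈∞⇒vp≥ k l n k≈l =
    toWitness {a? = + (p ^ suc n) ∣? (k - + res t (suc n))}
    ∘ subst T (sym (k≈l n))
    ∘ fromWitness {a? = + (p ^ suc n) ∣? (l - + res t (suc n))}

  vp-diff-aperiodic : 1 < p → ¬ Periodic _≈∞_ (vp-diff p t)
  vp-diff-aperiodic 1<p (suc j , _ , period) = ℕ.>⇒∤ (n<m^n p 1<p P) (∣⇒∣ᵤ pᴾ∣P)
    where
      P = suc j
      r = + res t P
      r+P-r≡P : (r + + P) - r ≡ + P
      r+P-r≡P = solve 2 (λ r P → (r :+ P) :- r := P) refl r (+ P)
      pᴾ∣P : + (p ^ P) ∣ + P
      pᴾ∣P = subst (+ (p ^ P) ∣_) r+P-r≡P (≈∞⇒vp≥ (r + + P) r j (period r) (vp≥-res P))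

vp-diff-almostPeriodic : ∀ p → 1 < p → (t : ℤ[ p ]) → AlmostPeriodic (vp-diff p t)
vp-diff-almostPeriodic p 1<p t = vp-diff-aperiodic p t 1<p , min∞-vp-diff-periodic p t
  where instance
    p≢0 : NonZero p
    p≢0 = >-nonZero (<-trans z<s 1<p)

lemma6p2 : ∀ (p : ℕ) → Prime p → (t : ℤ[ p ]) → AlmostPeriodic (vp-diff p t)
lemma6p2 p pr t = vp-diff-almostPeriodic p (nonTrivial⇒n>1 p) t
  where open Prime pr
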